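{- Let $\alpha(k)$ be the largest odd divisor of $k$, $G(n)=\sum_{k=1}^n\frac{n+1-k}{k}\alpha(k)$ and $g(n)=\frac{n(n+2)}{3}-G(n)$. For $r\ge0$ let $x_r=\frac23(2^{2r}-1)$ and $y_r=2x_r$. Then for all positive integers $p$ and $r$: $$g(2^{2r+2}p+x_r)<g(2^{2r+2}p+y_r),$$ $$g(2^{2r+2}p+2^{2r+1}+y_r)<g(2^{2r+2}p+x_{r+1}),$$ $$g(2^{2r+1}p+y_{r-1})<g(2^{2r+1}p+x_r),$$ $$g(2^{2r+1}p+2^{2r}+x_r)<g(2^{2r+1}p+y_r).$$
   Context: $\alpha(k)$ is the largest odd divisor of the positive integer $k$. -}

module Defs where

open import Data.Nat as ℕ using (ℕ; zero; suc; _∸_; _^_)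
open import Data.Nat.Divisibility using (_∣?_)
open import Data.Bool using (Bool; true; false; if_then_else_; _∧_)
open import Relation.Nullary.Decidable using (⌊_⌋)
open import Data.Integer using (+_)
open import Data.Rational using (ℚ; _/_; _+_; _-_; 0ℚ)

isOdd : ℕ → Bool
isOdd zero = false
isOdd (suc zero) = true
isOdd (suc (suc n)) = isOdd n

largestOddDivisorUpTo : ℕ → ℕ → ℕ
largestOddDivisorUpTo k zero = 0
largestOddDivisorUpTo k (suc m) =
  if isOdd (suc m) ∧ ⌊ suc m ∣? k ⌋ then suc m else largestOddDivisorUpTo k m

-- α(k): the largest odd divisor of k (every divisor of k ≥ 1 is ≤ k)
α : ℕ → ℕ
α k = largestOddDivisorUpTo k k

Gsum : ℕ → ℕ → ℚ
Gsum n zero = 0ℚ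
Gsum n (suc k) = Gsum n k + ((+ ((suc n ∸ suc k) ℕ.* α (suc k))) / suc k)

G : ℕ → ℚ
G n = Gsum n n

g : ℕ → ℚ
g n = ((+ (n ℕ.* (n ℕ.+ 2))) / 3) - G n

x : ℕ → ℕ
x r = (2 ℕ.* (2 ^ (2 ℕ.* r) ∸ 1)) ℕ./ 3

y : ℕ → ℕ
y r = 2 ℕ.* x r

-- Write c n = 2n/3 - Σ_{k≤n} α(k)/k, so that g (n + 1) = g n + c (n + 1) + 1/3.
-- Since α(2m) = α(m) and α(2m+1) = 2m+1, c and g obey binary recursions
--   c(2m) = c(m)/2,  c(2m+1) = c(m)/2 - 1/3,  g(2m) = g(m) - c(m)/2,  g(2m+1) = g(m),
-- which give -2/3 < c ≤ 0 (c < 0 on positive arguments) and, for L < 2^K,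
--   g(2^K H + L) = g(H) + g(L) - c(H) (1 - (L+1)/2^K).
-- So behind a common prefix p, g is larger at the offset L′ < 2^K than at L < 2^K
-- iff g(L′) - g(L) + c(p) (L′ - L)/2^K > 0. The offsets of the theorem are built
-- from x_r (binary 1010…10, so x_{r+1} = 4 x_r + 2), and all terms are explicit in
-- w = 4^{-r}: c(x_r) = -2(1-w)/9, g(y_r) = g(4^r + x_r), g(x_{r+1}) = g(2 (4^r + x_r)).
-- Each difference is then a positive multiple of c(p) + 2/3 or of -c(p).
module Submission where

module Properties where

  open import Defs
  open import Data.Bool using (true; false)
  open import Data.Bool.Properties using (∧-zeroʳ)
  open import Data.Empty using (⊥-elim)
  open import Data.Integer using (+_)
  import Data.Integer.Properties as ℤ
  open import Data.Nat as ℕ using (ℕ; zero; suc; s≤s; z≤n)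
  import Data.Nat.Properties as ℕ
  open import Data.Nat.Coprimality using (Coprime; coprime-+; gcd≡1⇒coprime; coprime-divisor)
  open import Data.Nat.Divisibility using (_∣?_; ∣-refl; ∣⇒≤; ∣n⇒∣m*n)
  open import Data.Nat.DivMod using (m*n/n≡m)
  open import Data.Nat.Induction using (<-rec)
  open import Data.Nat.Tactic.RingSolver using (solve-∀)
  open import Data.Product using (∃-syntax; _×_; _,_; proj₁; proj₂)
  open import Data.Sum using (_⊎_; inj₁; inj₂)
  open import Data.Rational using (ℚ; _/_; _+_; _-_; _*_; -_; 0ℚ; 1ℚ; ½; _<_; _≤_; positive; fromℚᵘ)
  import Data.Rational.Properties as ℚ
  open import Data.Rational.Unnormalised as ℚᵘ using (mkℚᵘ; _≃_)
  import Data.Rational.Unnormalised.Properties as ℚᵘ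
  open import Data.Rational.Solver using (module +-*-Solver)
  open +-*-Solver using (solve; _:+_; _:*_; _:-_; :-_; _:=_; con)
  open import Function using (_∘_)
  open import Relation.Binary.PropositionalEquality
  open import Relation.Nullary using (yes; no)
  open import Relation.Nullary.Decidable using (⌊_⌋)
  open ≡-Reasoning

  fromℚᵘ-homo-+ : ∀ p q → fromℚᵘ (p ℚᵘ.+ q) ≡ fromℚᵘ p + fromℚᵘ q
  fromℚᵘ-homo-+ p q = ℚ.toℚᵘ-injective (ℚᵘ.≃-trans (ℚ.toℚᵘ-fromℚᵘ (p ℚᵘ.+ q)) (ℚᵘ.≃-sym
    (ℚᵘ.≃-trans (ℚ.toℚᵘ-homo-+ (fromℚᵘ p) (fromℚᵘ q)) (ℚᵘ.+-cong (ℚ.toℚᵘ-fromℚᵘ p) (ℚ.toℚᵘ-fromℚᵘ q)))))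

  fromℚᵘ-homo-* : ∀ p q → fromℚᵘ (p ℚᵘ.* q) ≡ fromℚᵘ p * fromℚᵘ q
  fromℚᵘ-homo-* p q = ℚ.toℚᵘ-injective (ℚᵘ.≃-trans (ℚ.toℚᵘ-fromℚᵘ (p ℚᵘ.* q)) (ℚᵘ.≃-sym
    (ℚᵘ.≃-trans (ℚ.toℚᵘ-homo-* (fromℚᵘ p) (fromℚᵘ q)) (ℚᵘ.*-cong (ℚ.toℚᵘ-fromℚᵘ p) (ℚ.toℚᵘ-fromℚᵘ q)))))

  /-distribʳ-+ : ∀ a b d → + (a ℕ.+ b) / suc d ≡ + a / suc d + + b / suc d
  /-distribʳ-+ a b d = trans (ℚ.fromℚᵘ-cong sum) (fromℚᵘ-homo-+ (mkℚᵘ (+ a) d) (mkℚᵘ (+ b) d))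
    where
    sum : mkℚᵘ (+ (a ℕ.+ b)) d ≃ mkℚᵘ (+ a) d ℚᵘ.+ mkℚᵘ (+ b) d
    sum = ℚᵘ.≃-trans (ℚᵘ.≃-reflexive (ℚᵘ./-cong (ℤ.pos-+ a b) refl))
            (ℚᵘ.≃-trans (ℚᵘ.≃-sym (ℚᵘ.*-cancelʳ-/ (suc d)))
              (ℚᵘ.≃-reflexive (ℚᵘ./-cong (ℤ.*-distribʳ-+ (+ suc d) (+ a) (+ b)) refl)))

  /-2* : ∀ a m → + a / (2 ℕ.* suc m) ≡ + a / suc m * ½
  /-2* a m = trans (cong fromℚᵘ (ℚᵘ./-cong (sym (ℤ.*-identityʳ (+ a))) (ℕ.*-comm 2 (suc m))))
                   (fromℚᵘ-homo-* (mkℚᵘ (+ a) m) (mkℚᵘ (+ 1) 1))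

  n/n≡1 : ∀ n → + suc n / suc n ≡ 1ℚ
  n/n≡1 n = ℚ.fromℚᵘ-cong {mkℚᵘ (+ suc n) n} {mkℚᵘ (+ 1) 0} (ℚᵘ.*≡* (ℤ.*-comm (+ suc n) (+ 1)))

  -- The largest odd divisor

  isOdd⇒coprime-2 : ∀ d → isOdd d ≡ true → Coprime d 2
  isOdd⇒coprime-2 (suc zero)    _   = gcd≡1⇒coprime refl
  isOdd⇒coprime-2 (suc (suc d)) odd = coprime-+ (isOdd⇒coprime-2 d odd)

  isOdd-1+2* : ∀ m → isOdd (suc (2 ℕ.* m)) ≡ true
  isOdd-1+2* zero    = refl
  isOdd-1+2* (suc m) rewrite ℕ.+-suc m (m ℕ.+ 0) = isOdd-1+2* m

  odd-∣?-2* : ∀ d k → isOdd d ≡ true → ⌊ d ∣? 2 ℕ.* k ⌋ ≡ ⌊ d ∣? k ⌋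
  odd-∣?-2* d k odd with d ∣? 2 ℕ.* k | d ∣? k
  ... | yes _    | yes _   = refl
  ... | no _     | no _    = refl
  ... | yes d∣2k | no d∤k  = ⊥-elim (d∤k (coprime-divisor (isOdd⇒coprime-2 d odd) d∣2k))
  ... | no d∤2k  | yes d∣k = ⊥-elim (d∤2k (∣n⇒∣m*n 2 d∣k))

  largestOddDivisorUpTo-2* : ∀ k j → largestOddDivisorUpTo (2 ℕ.* k) j ≡ largestOddDivisorUpTo k j
  largestOddDivisorUpTo-2* k zero = refl
  largestOddDivisorUpTo-2* k (suc j) with isOdd (suc j) in odd
  ... | false = largestOddDivisorUpTo-2* k j
  ... | true rewrite odd-∣?-2* (suc j) k odd | largestOddDivisorUpTo-2* k j = refl

  largestOddDivisorUpTo-beyond : ∀ j k → largestOddDivisorUpTo (suc k) (j ℕ.+ suc k) ≡ α (suc k)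
  largestOddDivisorUpTo-beyond zero    k = refl
  largestOddDivisorUpTo-beyond (suc j) k with suc (j ℕ.+ suc k) ∣? suc k
  ... | yes d∣k = ⊥-elim (ℕ.<⇒≱ (s≤s (ℕ.m≤n+m (suc k) j)) (∣⇒≤ d∣k))
  ... | no _ rewrite ∧-zeroʳ (isOdd (suc (j ℕ.+ suc k))) = largestOddDivisorUpTo-beyond j k

  α-1+2* : ∀ m → α (suc (2 ℕ.* m)) ≡ suc (2 ℕ.* m)
  α-1+2* m rewrite isOdd-1+2* m with suc (2 ℕ.* m) ∣? suc (2 ℕ.* m)
  ... | yes _  = refl
  ... | no d∤d = ⊥-elim (d∤d ∣-refl)

  α-2* : ∀ m → α (2 ℕ.* suc m) ≡ α (suc m)
  α-2* m = begin
    largestOddDivisorUpTo (2 ℕ.* suc m) (2 ℕ.* suc m) ≡⟨ largestOddDivisorUpTo-2* (suc m) (2 ℕ.* suc m) ⟩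
    largestOddDivisorUpTo (suc m) (2 ℕ.* suc m)       ≡⟨ cong (largestOddDivisorUpTo (suc m) ∘ (suc m ℕ.+_)) (ℕ.+-identityʳ (suc m)) ⟩
    largestOddDivisorUpTo (suc m) (suc m ℕ.+ suc m)   ≡⟨ largestOddDivisorUpTo-beyond (suc m) m ⟩
    α (suc m)                                         ∎

  -- Binary recursions for c and g

  ⅓ ⅔ : ℚ
  ⅓ = + 1 / 3
  ⅔ = + 2 / 3

  a : ℕ → ℚ
  a zero    = 0ℚ
  a (suc k) = + α (suc k) / suc k

  a-1+2* : ∀ m → a (suc (2 ℕ.* m)) ≡ 1ℚ
  a-1+2* m = trans (cong (λ n → + n / suc (2 ℕ.* m)) (α-1+2* m)) (n/n≡1 (2 ℕ.* m))

  a-2* : ∀ m → a (2 ℕ.* suc m) ≡ a (suc m) * ½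
  a-2* m = trans (cong (λ n → + n / (2 ℕ.* suc m)) (α-2* m)) (/-2* (α (suc m)) m)

  S : ℕ → ℚ
  S zero    = 0ℚ
  S (suc n) = S n + a (suc n)

  c : ℕ → ℚ
  c n = + (2 ℕ.* n) / 3 - S n

  Gsum-suc : ∀ {n} k → k ℕ.≤ n → Gsum (suc n) k ≡ Gsum n k + S k
  Gsum-suc zero    _    = refl
  Gsum-suc {n} (suc k) k<n = begin
    Gsum (suc n) k + + ((suc n ℕ.∸ k) ℕ.* α (suc k)) / suc k
      ≡⟨ cong₂ (λ u m → u + + (m ℕ.* α (suc k)) / suc k) (Gsum-suc k (ℕ.<⇒≤ k<n)) (ℕ.+-∸-assoc 1 (ℕ.<⇒≤ k<n)) ⟩
    Gsum n k + S k + + (α (suc k) ℕ.+ (n ℕ.∸ k) ℕ.* α (suc k)) / suc k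
      ≡⟨ cong (λ t → Gsum n k + S k + t) (/-distribʳ-+ (α (suc k)) ((n ℕ.∸ k) ℕ.* α (suc k)) k) ⟩
    Gsum n k + S k + (a (suc k) + T)
      ≡⟨ solve 4 (λ u v a′ t → u :+ v :+ (a′ :+ t) := u :+ t :+ (v :+ a′)) refl (Gsum n k) (S k) (a (suc k)) T ⟩
    Gsum n (suc k) + S (suc k) ∎
    where T = + ((n ℕ.∸ k) ℕ.* α (suc k)) / suc k

  G-suc : ∀ n → G (suc n) ≡ G n + S (suc n)
  G-suc n = begin
    Gsum (suc n) n + + ((suc n ℕ.∸ n) ℕ.* α (suc n)) / suc n
      ≡⟨ cong₂ (λ u m → u + + (m ℕ.* α (suc n)) / suc n) (Gsum-suc n ℕ.≤-refl) (ℕ.m+n∸n≡m 1 n) ⟩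
    G n + S n + + (α (suc n) ℕ.+ 0) / suc n
      ≡⟨ cong (λ m → G n + S n + + m / suc n) (ℕ.+-identityʳ (α (suc n))) ⟩
    G n + S n + a (suc n)
      ≡⟨ solve 3 (λ u v a′ → u :+ v :+ a′ := u :+ (v :+ a′)) refl (G n) (S n) (a (suc n)) ⟩
    G n + S (suc n) ∎

  g-suc : ∀ n → g (suc n) ≡ g n + c (suc n) + ⅓
  g-suc n = begin
    + (suc n ℕ.* (suc n ℕ.+ 2)) / 3 - G (suc n)
      ≡⟨ cong₂ (λ m G′ → + m / 3 - G′) (expand n) (G-suc n) ⟩
    + (n ℕ.* (n ℕ.+ 2) ℕ.+ 2 ℕ.* suc n ℕ.+ 1) / 3 - (G n + S (suc n))
      ≡⟨ cong (_- (G n + S (suc n))) (trans (/-distribʳ-+ (n ℕ.* (n ℕ.+ 2) ℕ.+ 2 ℕ.* suc n) 1 2)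
                                               (cong (_+ ⅓) (/-distribʳ-+ (n ℕ.* (n ℕ.+ 2)) (2 ℕ.* suc n) 2))) ⟩
    + (n ℕ.* (n ℕ.+ 2)) / 3 + + (2 ℕ.* suc n) / 3 + ⅓ - (G n + S (suc n))
      ≡⟨ solve 5 (λ u v t G′ S′ → u :+ v :+ t :- (G′ :+ S′) := u :- G′ :+ (v :- S′) :+ t) refl
           (+ (n ℕ.* (n ℕ.+ 2)) / 3) (+ (2 ℕ.* suc n) / 3) ⅓ (G n) (S (suc n)) ⟩
    g n + c (suc n) + ⅓ ∎
    where
    expand : ∀ n → suc n ℕ.* (suc n ℕ.+ 2) ≡ n ℕ.* (n ℕ.+ 2) ℕ.+ 2 ℕ.* suc n ℕ.+ 1
    expand = solve-∀

  c-suc : ∀ n → c (suc n) ≡ c n + ⅔ - a (suc n)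
  c-suc n = begin
    + (2 ℕ.* suc n) / 3 - (S n + a (suc n))
      ≡⟨ cong (λ m → + m / 3 - (S n + a (suc n))) (trans (ℕ.*-suc 2 n) (ℕ.+-comm 2 (2 ℕ.* n))) ⟩
    + (2 ℕ.* n ℕ.+ 2) / 3 - (S n + a (suc n))
      ≡⟨ cong (_- (S n + a (suc n))) (/-distribʳ-+ (2 ℕ.* n) 2 2) ⟩
    + (2 ℕ.* n) / 3 + ⅔ - (S n + a (suc n))
      ≡⟨ solve 4 (λ u t S′ a′ → u :+ t :- (S′ :+ a′) := u :- S′ :+ t :- a′) refl (+ (2 ℕ.* n) / 3) ⅔ (S n) (a (suc n)) ⟩
    c n + ⅔ - a (suc n) ∎

  2*suc : ∀ m → 2 ℕ.* suc m ≡ suc (suc (2 ℕ.* m))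
  2*suc m = ℕ.*-suc 2 m

  c-2*   : ∀ m → c (2 ℕ.* m) ≡ c m * ½
  c-1+2* : ∀ m → c (suc (2 ℕ.* m)) ≡ c m * ½ - ⅓

  c-2* zero    = refl
  c-2* (suc m) = begin
    c (2 ℕ.* suc m)                               ≡⟨ cong c (2*suc m) ⟩
    c (suc (suc (2 ℕ.* m)))                       ≡⟨ c-suc (suc (2 ℕ.* m)) ⟩
    c (suc (2 ℕ.* m)) + ⅔ - a (suc (suc (2 ℕ.* m)))
      ≡⟨ cong₂ (λ u v → u + ⅔ - v) (c-1+2* m) (trans (cong a (sym (2*suc m))) (a-2* m)) ⟩
    c m * ½ - ⅓ + ⅔ - a (suc m) * ½
      ≡⟨ solve 2 (λ γ a′ → γ :* con ½ :- con ⅓ :+ con ⅔ :- a′ :* con ½ := (γ :+ con ⅔ :- a′) :* con ½) refl (c m) (a (suc m)) ⟩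
    (c m + ⅔ - a (suc m)) * ½                     ≡⟨ cong (_* ½) (c-suc m) ⟨
    c (suc m) * ½                                 ∎

  c-1+2* m = begin
    c (suc (2 ℕ.* m))                             ≡⟨ c-suc (2 ℕ.* m) ⟩
    c (2 ℕ.* m) + ⅔ - a (suc (2 ℕ.* m))           ≡⟨ cong₂ (λ u v → u + ⅔ - v) (c-2* m) (a-1+2* m) ⟩
    c m * ½ + ⅔ - 1ℚ                              ≡⟨ solve 1 (λ γ → γ :* con ½ :+ con ⅔ :- con 1ℚ := γ :* con ½ :- con ⅓) refl (c m) ⟩
    c m * ½ - ⅓                                   ∎

  g-1+2* : ∀ m → g (suc (2 ℕ.* m)) ≡ g m
  g-1+2* zero    = refl
  g-1+2* (suc m) = begin
    g (suc (2 ℕ.* suc m))                         ≡⟨ g-suc (2 ℕ.* suc m) ⟩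
    g (2 ℕ.* suc m) + c (suc (2 ℕ.* suc m)) + ⅓   ≡⟨ cong₂ (λ u v → u + v + ⅓) g-2*suc (c-1+2* (suc m)) ⟩
    g m + c (suc m) * ½ + ⅓ + (c (suc m) * ½ - ⅓) + ⅓
      ≡⟨ solve 2 (λ γ κ → γ :+ κ :* con ½ :+ con ⅓ :+ (κ :* con ½ :- con ⅓) :+ con ⅓ := γ :+ κ :+ con ⅓) refl (g m) (c (suc m)) ⟩
    g m + c (suc m) + ⅓                           ≡⟨ g-suc m ⟨
    g (suc m)                                     ∎
    where
    g-2*suc : g (2 ℕ.* suc m) ≡ g m + c (suc m) * ½ + ⅓
    g-2*suc = begin
      g (2 ℕ.* suc m)                                 ≡⟨ cong g (2*suc m) ⟩
      g (suc (suc (2 ℕ.* m)))                         ≡⟨ g-suc (suc (2 ℕ.* m)) ⟩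
      g (suc (2 ℕ.* m)) + c (suc (suc (2 ℕ.* m))) + ⅓ ≡⟨ cong₂ (λ u v → u + v + ⅓) (g-1+2* m) (trans (cong c (sym (2*suc m))) (c-2* (suc m))) ⟩
      g m + c (suc m) * ½ + ⅓                         ∎

  g-2* : ∀ m → g (2 ℕ.* m) ≡ g m - c m * ½
  g-2* m = begin
    g (2 ℕ.* m)
      ≡⟨ solve 3 (λ γ κ t → γ := γ :+ κ :+ t :- κ :- t) refl (g (2 ℕ.* m)) (c (suc (2 ℕ.* m))) ⅓ ⟩
    g (2 ℕ.* m) + c (suc (2 ℕ.* m)) + ⅓ - c (suc (2 ℕ.* m)) - ⅓
      ≡⟨ cong₂ (λ u v → u - v - ⅓) (sym (g-suc (2 ℕ.* m))) (c-1+2* m) ⟩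
    g (suc (2 ℕ.* m)) - (c m * ½ - ⅓) - ⅓
      ≡⟨ cong (λ u → u - (c m * ½ - ⅓) - ⅓) (g-1+2* m) ⟩
    g m - (c m * ½ - ⅓) - ⅓
      ≡⟨ solve 2 (λ γ κ → γ :- (κ :* con ½ :- con ⅓) :- con ⅓ := γ :- κ :* con ½) refl (g m) (c m) ⟩
    g m - c m * ½ ∎

  -- Bounds on c

  parity : ∀ n → ∃[ m ] (n ≡ 2 ℕ.* m ⊎ n ≡ suc (2 ℕ.* m))
  parity zero = 0 , inj₁ refl
  parity (suc n) with parity n
  ... | m , inj₁ refl = m , inj₂ refl
  ... | m , inj₂ refl = suc m , inj₁ (sym (2*suc m))

  binary-ind : (P : ℕ → Set) → P 0 → (∀ m → P m → P (suc (2 ℕ.* m))) →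
               (∀ m → P (suc m) → P (2 ℕ.* suc m)) → ∀ n → P n
  binary-ind P P0 P1+2* P2* = <-rec P step
    where
    step : ∀ n → (∀ {m} → m ℕ.< n → P m) → P n
    step n rec with parity n
    ... | zero  , inj₁ refl = P0
    ... | suc m , inj₁ refl = P2* m (rec (s≤s (ℕ.m<m+n m (s≤s z≤n))))
    ... | m     , inj₂ refl = P1+2* m (rec (s≤s (ℕ.m≤m+n m (m ℕ.+ 0))))

  *-pos : ∀ {p q} → 0ℚ < p → 0ℚ < q → 0ℚ < p * q
  *-pos {p} {q} 0<p 0<q = ℚ.positive⁻¹ (p * q) {{ℚ.pos*pos⇒pos p {{positive 0<p}} q {{positive 0<q}}}}

  0<½ : 0ℚ < ½
  0<½ = ℚ.positive⁻¹ ½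

  c-bounds : ∀ n → (0ℚ < c n + ⅔) × (0ℚ ≤ - c n)
  c-bounds = binary-ind _ (ℚ.positive⁻¹ ⅔ , ℚ.≤-refl) odd even
    where
    odd : ∀ m → (0ℚ < c m + ⅔) × (0ℚ ≤ - c m) → (0ℚ < c (suc (2 ℕ.* m)) + ⅔) × (0ℚ ≤ - c (suc (2 ℕ.* m)))
    odd m (lo , hi) =
        subst (0ℚ <_) (trans (solve 1 (λ γ → (γ :+ con ⅔) :* con ½ := γ :* con ½ :- con ⅓ :+ con ⅔) refl (c m))
                             (cong (_+ ⅔) (sym (c-1+2* m))))
              (*-pos lo 0<½)
      , subst (0ℚ ≤_) (trans (solve 1 (λ γ → (:- γ) :* con ½ :+ con ⅓ := :- (γ :* con ½ :- con ⅓)) refl (c m))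
                             (cong -_ (sym (c-1+2* m))))
              (ℚ.<⇒≤ (ℚ.+-mono-≤-< (ℚ.*-monoʳ-≤-nonNeg ½ hi) (ℚ.positive⁻¹ ⅓)))
    even : ∀ m → (0ℚ < c (suc m) + ⅔) × (0ℚ ≤ - c (suc m)) → (0ℚ < c (2 ℕ.* suc m) + ⅔) × (0ℚ ≤ - c (2 ℕ.* suc m))
    even m (lo , hi) =
        subst (0ℚ <_) (trans (solve 1 (λ γ → (γ :+ con ⅔) :* con ½ :+ con ⅓ := γ :* con ½ :+ con ⅔) refl (c (suc m)))
                             (cong (_+ ⅔) (sym (c-2* (suc m)))))
              (ℚ.+-mono-< (*-pos lo 0<½) (ℚ.positive⁻¹ ⅓))
      , subst (0ℚ ≤_) (trans (solve 1 (λ γ → (:- γ) :* con ½ := :- (γ :* con ½)) refl (c (suc m)))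
                             (cong -_ (sym (c-2* (suc m)))))
              (ℚ.*-monoʳ-≤-nonNeg ½ hi)

  c<0 : ∀ {n} → 1 ℕ.≤ n → 0ℚ < - c n
  c<0 {n} = binary-ind (λ n → 1 ℕ.≤ n → 0ℚ < - c n) (λ ()) odd even n
    where
    odd : ∀ m → (1 ℕ.≤ m → 0ℚ < - c m) → 1 ℕ.≤ suc (2 ℕ.* m) → 0ℚ < - c (suc (2 ℕ.* m))
    odd m _ _ = subst (0ℚ <_) (trans (solve 1 (λ γ → (:- γ) :* con ½ :+ con ⅓ := :- (γ :* con ½ :- con ⅓)) refl (c m))
                                     (cong -_ (sym (c-1+2* m))))
                      (ℚ.+-mono-≤-< (ℚ.*-monoʳ-≤-nonNeg ½ (proj₂ (c-bounds m))) (ℚ.positive⁻¹ ⅓))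
    even : ∀ m → (1 ℕ.≤ suc m → 0ℚ < - c (suc m)) → 1 ℕ.≤ 2 ℕ.* suc m → 0ℚ < - c (2 ℕ.* suc m)
    even m ih _ = subst (0ℚ <_) (trans (solve 1 (λ γ → (:- γ) :* con ½ := :- (γ :* con ½)) refl (c (suc m)))
                                       (cong -_ (sym (c-2* (suc m)))))
                        (*-pos (ih (s≤s z≤n)) 0<½)

  -- Appending binary digits

  fromℕ : ℕ → ℚ
  fromℕ n = + n / 1

  fromℕ-+ : ∀ m n → fromℕ (m ℕ.+ n) ≡ fromℕ m + fromℕ n
  fromℕ-+ m n = /-distribʳ-+ m n 0

  fromℕ-2* : ∀ n → fromℕ (2 ℕ.* n) ≡ fromℕ n + fromℕ n
  fromℕ-2* n = trans (fromℕ-+ n (n ℕ.+ 0)) (cong (λ m → fromℕ n + fromℕ m) (ℕ.+-identityʳ n))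

  ½^_ : ℕ → ℚ
  ½^ zero  = 1ℚ
  ½^ suc n = ½ * ½^ n

  fromℕ-2^*½^ : ∀ n → fromℕ (2 ℕ.^ n) * ½^ n ≡ 1ℚ
  fromℕ-2^*½^ zero    = refl
  fromℕ-2^*½^ (suc n) = begin
    fromℕ (2 ℕ.* 2 ℕ.^ n) * (½ * ½^ n)              ≡⟨ cong (_* (½ * ½^ n)) (fromℕ-2* (2 ℕ.^ n)) ⟩
    (fromℕ (2 ℕ.^ n) + fromℕ (2 ℕ.^ n)) * (½ * ½^ n) ≡⟨ solve 2 (λ e w → (e :+ e) :* (con ½ :* w) := e :* w) refl (fromℕ (2 ℕ.^ n)) (½^ n) ⟩
    fromℕ (2 ℕ.^ n) * ½^ n                           ≡⟨ fromℕ-2^*½^ n ⟩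
    1ℚ                                               ∎

  ½^-pos : ∀ n → 0ℚ < ½^ n
  ½^-pos zero    = ℚ.positive⁻¹ 1ℚ
  ½^-pos (suc n) = *-pos 0<½ (½^-pos n)

  ½^-≤1 : ∀ n → 0ℚ ≤ 1ℚ - ½^ n
  ½^-<1 : ∀ {n} → 1 ℕ.≤ n → 0ℚ < 1ℚ - ½^ n
  ½^-≤1 zero    = ℚ.≤-refl
  ½^-≤1 (suc n) = ℚ.<⇒≤ (½^-<1 {suc n} (s≤s z≤n))
  ½^-<1 {suc n} _ = subst (0ℚ <_) (solve 1 (λ w → (con 1ℚ :- w) :* con ½ :+ con ½ := con 1ℚ :- con ½ :* w) refl (½^ n))
                          (ℚ.+-mono-≤-< (ℚ.*-monoʳ-≤-nonNeg ½ (½^-≤1 n)) 0<½)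

  fromℕ-1+2* : ∀ n → fromℕ (suc (2 ℕ.* n)) ≡ 1ℚ + (fromℕ n + fromℕ n)
  fromℕ-1+2* n = trans (fromℕ-+ 1 (2 ℕ.* n)) (cong (_+_ 1ℚ) (fromℕ-2* n))

  Splits : ℕ → ℕ → ℕ → Set
  Splits K H L = (g (2 ℕ.^ K ℕ.* H ℕ.+ L) ≡ g H + g L - c H * (1ℚ - (fromℕ L + 1ℚ) * ½^ K))
               × (c (2 ℕ.^ K ℕ.* H ℕ.+ L) ≡ c H * ½^ K + c L)

  splits-0 : ∀ H → Splits 0 H 0
  splits-0 H = g-split , c-split
    where
    H≡ : 1 ℕ.* H ℕ.+ 0 ≡ H
    H≡ = trans (ℕ.+-identityʳ (1 ℕ.* H)) (ℕ.*-identityˡ H)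
    g-split : g (1 ℕ.* H ℕ.+ 0) ≡ g H + g 0 - c H * (1ℚ - (fromℕ 0 + 1ℚ) * 1ℚ)
    g-split = trans (cong g H≡) (solve 2 (λ γ κ → γ := γ :+ con 0ℚ :- κ :* (con 1ℚ :- (con 0ℚ :+ con 1ℚ) :* con 1ℚ)) refl (g H) (c H))
    c-split : c (1 ℕ.* H ℕ.+ 0) ≡ c H * 1ℚ + c 0
    c-split = trans (cong c H≡) (solve 1 (λ κ → κ := κ :* con 1ℚ :+ con 0ℚ) refl (c H))

  splits-2* : ∀ K H L → Splits K H L → Splits (suc K) H (2 ℕ.* L)
  splits-2* K H L (g-split , c-split) = g-split′ , c-split′
    where
    M = 2 ℕ.^ K ℕ.* H
    N≡ : 2 ℕ.^ suc K ℕ.* H ℕ.+ 2 ℕ.* L ≡ 2 ℕ.* (M ℕ.+ L)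
    N≡ = regroup (2 ℕ.^ K) H L
      where
      regroup : ∀ P H L → 2 ℕ.* P ℕ.* H ℕ.+ 2 ℕ.* L ≡ 2 ℕ.* (P ℕ.* H ℕ.+ L)
      regroup = solve-∀
    g-split′ : g (2 ℕ.^ suc K ℕ.* H ℕ.+ 2 ℕ.* L) ≡ g H + g (2 ℕ.* L) - c H * (1ℚ - (fromℕ (2 ℕ.* L) + 1ℚ) * ½^ suc K)
    g-split′ = begin
      g (2 ℕ.^ suc K ℕ.* H ℕ.+ 2 ℕ.* L)                  ≡⟨ cong g N≡ ⟩
      g (2 ℕ.* (M ℕ.+ L))                                ≡⟨ g-2* (M ℕ.+ L) ⟩
      g (M ℕ.+ L) - c (M ℕ.+ L) * ½                      ≡⟨ cong₂ (λ u v → u - v * ½) g-split c-split ⟩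
      g H + g L - c H * (1ℚ - (fromℕ L + 1ℚ) * ½^ K) - (c H * ½^ K + c L) * ½
        ≡⟨ solve 6 (λ γ γ′ κ κ′ ℓ w → γ :+ γ′ :- κ :* (con 1ℚ :- (ℓ :+ con 1ℚ) :* w) :- (κ :* w :+ κ′) :* con ½
                                   := γ :+ (γ′ :- κ′ :* con ½) :- κ :* (con 1ℚ :- ((ℓ :+ ℓ) :+ con 1ℚ) :* (con ½ :* w)))
                 refl (g H) (g L) (c H) (c L) (fromℕ L) (½^ K) ⟩
      g H + (g L - c L * ½) - c H * (1ℚ - ((fromℕ L + fromℕ L) + 1ℚ) * ½^ suc K)
        ≡⟨ cong₂ (λ u v → g H + u - c H * (1ℚ - (v + 1ℚ) * ½^ suc K)) (sym (g-2* L)) (sym (fromℕ-2* L)) ⟩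
      g H + g (2 ℕ.* L) - c H * (1ℚ - (fromℕ (2 ℕ.* L) + 1ℚ) * ½^ suc K) ∎
    c-split′ : c (2 ℕ.^ suc K ℕ.* H ℕ.+ 2 ℕ.* L) ≡ c H * ½^ suc K + c (2 ℕ.* L)
    c-split′ = begin
      c (2 ℕ.^ suc K ℕ.* H ℕ.+ 2 ℕ.* L)   ≡⟨ cong c N≡ ⟩
      c (2 ℕ.* (M ℕ.+ L))                 ≡⟨ c-2* (M ℕ.+ L) ⟩
      c (M ℕ.+ L) * ½                     ≡⟨ cong (_* ½) c-split ⟩
      (c H * ½^ K + c L) * ½              ≡⟨ solve 3 (λ κ w κ′ → (κ :* w :+ κ′) :* con ½ := κ :* (con ½ :* w) :+ κ′ :* con ½) refl (c H) (½^ K) (c L) ⟩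
      c H * ½^ suc K + c L * ½            ≡⟨ cong (λ v → c H * ½^ suc K + v) (sym (c-2* L)) ⟩
      c H * ½^ suc K + c (2 ℕ.* L)        ∎

  splits-1+2* : ∀ K H L → Splits K H L → Splits (suc K) H (suc (2 ℕ.* L))
  splits-1+2* K H L (g-split , c-split) = g-split′ , c-split′
    where
    M = 2 ℕ.^ K ℕ.* H
    N≡ : 2 ℕ.^ suc K ℕ.* H ℕ.+ suc (2 ℕ.* L) ≡ suc (2 ℕ.* (M ℕ.+ L))
    N≡ = regroup (2 ℕ.^ K) H L
      where
      regroup : ∀ P H L → 2 ℕ.* P ℕ.* H ℕ.+ suc (2 ℕ.* L) ≡ suc (2 ℕ.* (P ℕ.* H ℕ.+ L))
      regroup = solve-∀
    g-split′ : g (2 ℕ.^ suc K ℕ.* H ℕ.+ suc (2 ℕ.* L)) ≡ g H + g (suc (2 ℕ.* L)) - c H * (1ℚ - (fromℕ (suc (2 ℕ.* L)) + 1ℚ) * ½^ suc K)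
    g-split′ = begin
      g (2 ℕ.^ suc K ℕ.* H ℕ.+ suc (2 ℕ.* L))            ≡⟨ cong g N≡ ⟩
      g (suc (2 ℕ.* (M ℕ.+ L)))                          ≡⟨ g-1+2* (M ℕ.+ L) ⟩
      g (M ℕ.+ L)                                        ≡⟨ g-split ⟩
      g H + g L - c H * (1ℚ - (fromℕ L + 1ℚ) * ½^ K)
        ≡⟨ solve 5 (λ γ γ′ κ ℓ w → γ :+ γ′ :- κ :* (con 1ℚ :- (ℓ :+ con 1ℚ) :* w)
                                := γ :+ γ′ :- κ :* (con 1ℚ :- ((con 1ℚ :+ (ℓ :+ ℓ)) :+ con 1ℚ) :* (con ½ :* w)))
                 refl (g H) (g L) (c H) (fromℕ L) (½^ K) ⟩
      g H + g L - c H * (1ℚ - ((1ℚ + (fromℕ L + fromℕ L)) + 1ℚ) * ½^ suc K)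
        ≡⟨ cong₂ (λ u v → g H + u - c H * (1ℚ - (v + 1ℚ) * ½^ suc K)) (sym (g-1+2* L)) (sym (fromℕ-1+2* L)) ⟩
      g H + g (suc (2 ℕ.* L)) - c H * (1ℚ - (fromℕ (suc (2 ℕ.* L)) + 1ℚ) * ½^ suc K) ∎
    c-split′ : c (2 ℕ.^ suc K ℕ.* H ℕ.+ suc (2 ℕ.* L)) ≡ c H * ½^ suc K + c (suc (2 ℕ.* L))
    c-split′ = begin
      c (2 ℕ.^ suc K ℕ.* H ℕ.+ suc (2 ℕ.* L))   ≡⟨ cong c N≡ ⟩
      c (suc (2 ℕ.* (M ℕ.+ L)))                 ≡⟨ c-1+2* (M ℕ.+ L) ⟩
      c (M ℕ.+ L) * ½ - ⅓                       ≡⟨ cong (λ v → v * ½ - ⅓) c-split ⟩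
      (c H * ½^ K + c L) * ½ - ⅓
        ≡⟨ solve 3 (λ κ w κ′ → (κ :* w :+ κ′) :* con ½ :- con ⅓ := κ :* (con ½ :* w) :+ (κ′ :* con ½ :- con ⅓)) refl (c H) (½^ K) (c L) ⟩
      c H * ½^ suc K + (c L * ½ - ⅓)            ≡⟨ cong (λ v → c H * ½^ suc K + v) (sym (c-1+2* L)) ⟩
      c H * ½^ suc K + c (suc (2 ℕ.* L))        ∎

  splits : ∀ K H L → L ℕ.< 2 ℕ.^ K → Splits K H L
  splits zero    H zero    _ = splits-0 H
  splits zero    H (suc L) (s≤s ())
  splits (suc K) H L L<2^[1+K] with parity L
  ... | L′ , inj₁ refl = splits-2* K H L′ (splits K H L′ (ℕ.*-cancelˡ-< 2 L′ (2 ℕ.^ K) L<2^[1+K]))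
  ... | L′ , inj₂ refl = splits-1+2* K H L′ (splits K H L′ (ℕ.*-cancelˡ-< 2 L′ (2 ℕ.^ K) (ℕ.<-trans (ℕ.n<1+n (2 ℕ.* L′)) L<2^[1+K])))

  -- The sequence x

  -- x is defined by truncated division; this equation pins it down.
  x-unique : ∀ r m → 3 ℕ.* m ℕ.+ 2 ≡ 2 ℕ.* 2 ℕ.^ (2 ℕ.* r) → x r ≡ m
  x-unique r m eq = begin
    2 ℕ.* (2 ℕ.^ (2 ℕ.* r) ℕ.∸ 1) ℕ./ 3  ≡⟨ cong (ℕ._/ 3) (trans (ℕ.*-distribˡ-∸ 2 (2 ℕ.^ (2 ℕ.* r)) 1) (cong (ℕ._∸ 2) (sym eq))) ⟩
    (3 ℕ.* m ℕ.+ 2 ℕ.∸ 2) ℕ./ 3           ≡⟨ cong (ℕ._/ 3) (trans (ℕ.m+n∸n≡m (3 ℕ.* m) 2) (ℕ.*-comm 3 m)) ⟩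
    m ℕ.* 3 ℕ./ 3                         ≡⟨ m*n/n≡m m 3 ⟩
    m                                     ∎

  3m+2≡2*4^-step : ∀ r m → 3 ℕ.* m ℕ.+ 2 ≡ 2 ℕ.* 2 ℕ.^ (2 ℕ.* r) → 3 ℕ.* (2 ℕ.* suc (2 ℕ.* m)) ℕ.+ 2 ≡ 2 ℕ.* 2 ℕ.^ (2 ℕ.* suc r)
  3m+2≡2*4^-step r m eq = begin
    3 ℕ.* (2 ℕ.* suc (2 ℕ.* m)) ℕ.+ 2      ≡⟨ regroup m ⟩
    2 ℕ.* (2 ℕ.* (3 ℕ.* m ℕ.+ 2))          ≡⟨ cong (λ k → 2 ℕ.* (2 ℕ.* k)) eq ⟩
    2 ℕ.* (2 ℕ.* (2 ℕ.* 2 ℕ.^ (2 ℕ.* r)))  ≡⟨ cong (λ k → 2 ℕ.* 2 ℕ.^ k) (ℕ.*-suc 2 r) ⟨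
    2 ℕ.* 2 ℕ.^ (2 ℕ.* suc r)              ∎
    where
    regroup : ∀ m → 3 ℕ.* (2 ℕ.* suc (2 ℕ.* m)) ℕ.+ 2 ≡ 2 ℕ.* (2 ℕ.* (3 ℕ.* m ℕ.+ 2))
    regroup = solve-∀

  3x+2≡2*4^ : ∀ r → 3 ℕ.* x r ℕ.+ 2 ≡ 2 ℕ.* 2 ℕ.^ (2 ℕ.* r)
  x-suc     : ∀ r → x (suc r) ≡ 2 ℕ.* suc (2 ℕ.* x r)

  3x+2≡2*4^ zero    = refl
  3x+2≡2*4^ (suc r) rewrite x-suc r = 3m+2≡2*4^-step r (x r) (3x+2≡2*4^ r)

  x-suc r = x-unique (suc r) (2 ℕ.* suc (2 ℕ.* x r)) (3m+2≡2*4^-step r (x r) (3x+2≡2*4^ r))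

  x<4^ : ∀ r → x r ℕ.< 2 ℕ.^ (2 ℕ.* r)
  x<4^ r = ℕ.*-cancelˡ-≤ 2 (subst (2 ℕ.* suc (x r) ℕ.≤_) (trans (regroup (x r)) (3x+2≡2*4^ r))
                                  (ℕ.m≤n+m (2 ℕ.* suc (x r)) (x r)))
    where
    regroup : ∀ m → m ℕ.+ 2 ℕ.* suc m ≡ 3 ℕ.* m ℕ.+ 2
    regroup = solve-∀

  ½^-2*suc : ∀ r → ½^ (2 ℕ.* suc r) ≡ ½ * (½ * ½^ (2 ℕ.* r))
  ½^-2*suc r = cong ½^_ (ℕ.*-suc 2 r)

  fromℕ-x-suc : ∀ r → fromℕ (x (suc r)) ≡ (1ℚ + (fromℕ (x r) + fromℕ (x r))) + (1ℚ + (fromℕ (x r) + fromℕ (x r)))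
  fromℕ-x-suc r = trans (cong fromℕ (x-suc r)) (trans (fromℕ-2* (suc (2 ℕ.* x r))) (cong₂ _+_ (fromℕ-1+2* (x r)) (fromℕ-1+2* (x r))))

  fromℕ-x*½^ : ∀ r → fromℕ (x r) * ½^ (2 ℕ.* r) ≡ ⅔ * (1ℚ - ½^ (2 ℕ.* r))
  fromℕ-x*½^ zero    = refl
  fromℕ-x*½^ (suc r) = begin
    fromℕ (x (suc r)) * ½^ (2 ℕ.* suc r)
      ≡⟨ cong₂ _*_ (fromℕ-x-suc r) (½^-2*suc r) ⟩
    ((1ℚ + (X + X)) + (1ℚ + (X + X))) * (½ * (½ * w))
      ≡⟨ solve 2 (λ X w → ((con 1ℚ :+ (X :+ X)) :+ (con 1ℚ :+ (X :+ X))) :* (con ½ :* (con ½ :* w)) := X :* w :+ con ½ :* w) refl X w ⟩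
    X * w + ½ * w                   ≡⟨ cong (_+ ½ * w) (fromℕ-x*½^ r) ⟩
    ⅔ * (1ℚ - w) + ½ * w            ≡⟨ solve 1 (λ w → con ⅔ :* (con 1ℚ :- w) :+ con ½ :* w := con ⅔ :* (con 1ℚ :- con ½ :* (con ½ :* w))) refl w ⟩
    ⅔ * (1ℚ - ½ * (½ * w))          ≡⟨ cong (λ v → ⅔ * (1ℚ - v)) (½^-2*suc r) ⟨
    ⅔ * (1ℚ - ½^ (2 ℕ.* suc r))     ∎
    where
    X = fromℕ (x r)
    w = ½^ (2 ℕ.* r)

  c-x : ∀ r → c (x r) ≡ - (+ 2 / 9) * (1ℚ - ½^ (2 ℕ.* r))
  c-x zero    = refl
  c-x (suc r) = begin
    c (x (suc r))                              ≡⟨ cong c (x-suc r) ⟩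
    c (2 ℕ.* suc (2 ℕ.* x r))                  ≡⟨ c-2* (suc (2 ℕ.* x r)) ⟩
    c (suc (2 ℕ.* x r)) * ½                    ≡⟨ cong (_* ½) (c-1+2* (x r)) ⟩
    (c (x r) * ½ - ⅓) * ½                      ≡⟨ cong (λ v → (v * ½ - ⅓) * ½) (c-x r) ⟩
    (- (+ 2 / 9) * (1ℚ - w) * ½ - ⅓) * ½
      ≡⟨ solve 1 (λ w → (con (- (+ 2 / 9)) :* (con 1ℚ :- w) :* con ½ :- con ⅓) :* con ½
                      := con (- (+ 2 / 9)) :* (con 1ℚ :- con ½ :* (con ½ :* w))) refl w ⟩
    - (+ 2 / 9) * (1ℚ - ½ * (½ * w))           ≡⟨ cong (λ v → - (+ 2 / 9) * (1ℚ - v)) (½^-2*suc r) ⟨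
    - (+ 2 / 9) * (1ℚ - ½^ (2 ℕ.* suc r))      ∎
    where
    w = ½^ (2 ℕ.* r)

  g-2x : ∀ r → g (2 ℕ.* x r) ≡ g (x r) + + 1 / 9 * (1ℚ - ½^ (2 ℕ.* r))
  g-2x r = begin
    g (2 ℕ.* x r)                               ≡⟨ g-2* (x r) ⟩
    g (x r) - c (x r) * ½                       ≡⟨ cong (λ v → g (x r) - v * ½) (c-x r) ⟩
    g (x r) - - (+ 2 / 9) * (1ℚ - w) * ½
      ≡⟨ solve 2 (λ γ w → γ :- con (- (+ 2 / 9)) :* (con 1ℚ :- w) :* con ½ := γ :+ con (+ 1 / 9) :* (con 1ℚ :- w)) refl (g (x r)) w ⟩
    g (x r) + + 1 / 9 * (1ℚ - w)                ∎
    where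
    w = ½^ (2 ℕ.* r)

  g-x-suc : ∀ r → g (x (suc r)) ≡ g (x r) + + 1 / 18 * (+ 4 / 1 - ½^ (2 ℕ.* r))
  g-x-suc r = begin
    g (x (suc r))                               ≡⟨ cong g (x-suc r) ⟩
    g (2 ℕ.* suc (2 ℕ.* x r))                   ≡⟨ g-2* (suc (2 ℕ.* x r)) ⟩
    g (suc (2 ℕ.* x r)) - c (suc (2 ℕ.* x r)) * ½ ≡⟨ cong₂ (λ u v → u - v * ½) (g-1+2* (x r)) (c-1+2* (x r)) ⟩
    g (x r) - (c (x r) * ½ - ⅓) * ½             ≡⟨ cong (λ v → g (x r) - (v * ½ - ⅓) * ½) (c-x r) ⟩
    g (x r) - (- (+ 2 / 9) * (1ℚ - w) * ½ - ⅓) * ½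
      ≡⟨ solve 2 (λ γ w → γ :- (con (- (+ 2 / 9)) :* (con 1ℚ :- w) :* con ½ :- con ⅓) :* con ½
                        := γ :+ con (+ 1 / 18) :* (con (+ 4 / 1) :- w)) refl (g (x r)) w ⟩
    g (x r) + + 1 / 18 * (+ 4 / 1 - w)          ∎
    where
    w = ½^ (2 ℕ.* r)

  g-4^+x : ∀ r → g (2 ℕ.^ (2 ℕ.* r) ℕ.+ x r) ≡ g (x r) + + 1 / 9 * (1ℚ - ½^ (2 ℕ.* r))
  g-4^+x r = begin
    g (2 ℕ.^ (2 ℕ.* r) ℕ.+ x r)                   ≡⟨ cong (λ n → g (n ℕ.+ x r)) (ℕ.*-identityʳ (2 ℕ.^ (2 ℕ.* r))) ⟨
    g (2 ℕ.^ (2 ℕ.* r) ℕ.* 1 ℕ.+ x r)             ≡⟨ proj₁ (splits (2 ℕ.* r) 1 (x r) (x<4^ r)) ⟩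
    g 1 + g (x r) - c 1 * (1ℚ - (X + 1ℚ) * w)
      ≡⟨ solve 3 (λ γ X w → con (g 1) :+ γ :- con (c 1) :* (con 1ℚ :- (X :+ con 1ℚ) :* w)
                          := γ :+ con ⅓ :* (con 1ℚ :- w) :- con ⅓ :* (X :* w)) refl (g (x r)) X w ⟩
    g (x r) + ⅓ * (1ℚ - w) - ⅓ * (X * w)          ≡⟨ cong (λ v → g (x r) + ⅓ * (1ℚ - w) - ⅓ * v) (fromℕ-x*½^ r) ⟩
    g (x r) + ⅓ * (1ℚ - w) - ⅓ * (⅔ * (1ℚ - w))
      ≡⟨ solve 2 (λ γ w → γ :+ con ⅓ :* (con 1ℚ :- w) :- con ⅓ :* (con ⅔ :* (con 1ℚ :- w)) := γ :+ con (+ 1 / 9) :* (con 1ℚ :- w)) refl (g (x r)) w ⟩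
    g (x r) + + 1 / 9 * (1ℚ - w)                  ∎
    where
    X = fromℕ (x r)
    w = ½^ (2 ℕ.* r)

  c-4^+x : ∀ r → c (2 ℕ.^ (2 ℕ.* r) ℕ.+ x r) ≡ c (x r) - ⅓ * ½^ (2 ℕ.* r)
  c-4^+x r = begin
    c (2 ℕ.^ (2 ℕ.* r) ℕ.+ x r)                   ≡⟨ cong (λ n → c (n ℕ.+ x r)) (ℕ.*-identityʳ (2 ℕ.^ (2 ℕ.* r))) ⟨
    c (2 ℕ.^ (2 ℕ.* r) ℕ.* 1 ℕ.+ x r)             ≡⟨ proj₂ (splits (2 ℕ.* r) 1 (x r) (x<4^ r)) ⟩
    c 1 * ½^ (2 ℕ.* r) + c (x r)
      ≡⟨ solve 2 (λ κ w → con (c 1) :* w :+ κ := κ :- con ⅓ :* w) refl (c (x r)) (½^ (2 ℕ.* r)) ⟩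
    c (x r) - ⅓ * ½^ (2 ℕ.* r)                    ∎

  g-2[4^+x] : ∀ r → g (2 ℕ.* (2 ℕ.^ (2 ℕ.* r) ℕ.+ x r)) ≡ g (x r) + + 1 / 18 * (+ 4 / 1 - ½^ (2 ℕ.* r))
  g-2[4^+x] r = begin
    g (2 ℕ.* Q)                                   ≡⟨ g-2* Q ⟩
    g Q - c Q * ½                                 ≡⟨ cong₂ (λ u v → u - v * ½) (g-4^+x r) (c-4^+x r) ⟩
    g (x r) + + 1 / 9 * (1ℚ - w) - (c (x r) - ⅓ * w) * ½ ≡⟨ cong (λ v → g (x r) + + 1 / 9 * (1ℚ - w) - (v - ⅓ * w) * ½) (c-x r) ⟩
    g (x r) + + 1 / 9 * (1ℚ - w) - (- (+ 2 / 9) * (1ℚ - w) - ⅓ * w) * ½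
      ≡⟨ solve 2 (λ γ w → γ :+ con (+ 1 / 9) :* (con 1ℚ :- w) :- (con (- (+ 2 / 9)) :* (con 1ℚ :- w) :- con ⅓ :* w) :* con ½
                        := γ :+ con (+ 1 / 18) :* (con (+ 4 / 1) :- w)) refl (g (x r)) w ⟩
    g (x r) + + 1 / 18 * (+ 4 / 1 - w)            ∎
    where
    Q = 2 ℕ.^ (2 ℕ.* r) ℕ.+ x r
    w = ½^ (2 ℕ.* r)

  g-offset-< : ∀ K H {L L′ γ σ} → L ℕ.< 2 ℕ.^ K → L′ ℕ.< 2 ℕ.^ K →
               g L′ - g L ≡ γ → (fromℕ L′ - fromℕ L) * ½^ K ≡ σ → 0ℚ < γ + c H * σ →
               g (2 ℕ.^ K ℕ.* H ℕ.+ L) < g (2 ℕ.^ K ℕ.* H ℕ.+ L′)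
  g-offset-< K H {L} {L′} {γ} {σ} L<2^K L′<2^K refl refl 0<Δ =
    subst (g N <_) (sym g-N′) (ℚ.<-respˡ-≡ (ℚ.+-identityʳ (g N)) (ℚ.+-monoʳ-< (g N) 0<Δ))
    where
    N = 2 ℕ.^ K ℕ.* H ℕ.+ L
    g-N′ : g (2 ℕ.^ K ℕ.* H ℕ.+ L′) ≡ g N + (γ + c H * σ)
    g-N′ = begin
      g (2 ℕ.^ K ℕ.* H ℕ.+ L′)                            ≡⟨ proj₁ (splits K H L′ L′<2^K) ⟩
      g H + g L′ - c H * (1ℚ - (fromℕ L′ + 1ℚ) * ½^ K)
        ≡⟨ solve 7 (λ γ γ′ γ″ κ ℓ′ ℓ w → γ :+ γ′ :- κ :* (con 1ℚ :- (ℓ′ :+ con 1ℚ) :* w)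
                                      := γ :+ γ″ :- κ :* (con 1ℚ :- (ℓ :+ con 1ℚ) :* w) :+ (γ′ :- γ″ :+ κ :* ((ℓ′ :- ℓ) :* w)))
                   refl (g H) (g L′) (g L) (c H) (fromℕ L′) (fromℕ L) (½^ K) ⟩
      g H + g L - c H * (1ℚ - (fromℕ L + 1ℚ) * ½^ K) + (γ + c H * σ)  ≡⟨ cong (_+ (γ + c H * σ)) (proj₁ (splits K H L L<2^K)) ⟨
      g N + (γ + c H * σ)                                              ∎

  ½^[n+1] : ∀ n → ½^ (n ℕ.+ 1) ≡ ½ * ½^ n
  ½^[n+1] n = cong ½^_ (ℕ.+-comm n 1)

  ½^[n+2] : ∀ n → ½^ (n ℕ.+ 2) ≡ ½ * (½ * ½^ n)
  ½^[n+2] n = cong ½^_ (ℕ.+-comm n 2)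

  2^[n+1] : ∀ n → 2 ℕ.^ (n ℕ.+ 1) ≡ 2 ℕ.* 2 ℕ.^ n
  2^[n+1] n = cong (2 ℕ.^_) (ℕ.+-comm n 1)

  2^[n+2] : ∀ n → 2 ℕ.^ (n ℕ.+ 2) ≡ 2 ℕ.* (2 ℕ.* 2 ℕ.^ n)
  2^[n+2] n = cong (2 ℕ.^_) (ℕ.+-comm n 2)

  4^+x<2*4^ : ∀ r → 2 ℕ.^ (2 ℕ.* r) ℕ.+ x r ℕ.< 2 ℕ.* 2 ℕ.^ (2 ℕ.* r)
  4^+x<2*4^ r = subst (2 ℕ.^ (2 ℕ.* r) ℕ.+ x r ℕ.<_) (cong (P ℕ.+_) (sym (ℕ.+-identityʳ P))) (ℕ.+-monoʳ-< P (x<4^ r))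
    where P = 2 ℕ.^ (2 ℕ.* r)

  0<⅙ : 0ℚ < + 1 / 6
  0<⅙ = ℚ.positive⁻¹ (+ 1 / 6)

  g-x<g-y : ∀ p r → 1 ℕ.≤ r →
            g (2 ℕ.^ (2 ℕ.* r ℕ.+ 2) ℕ.* p ℕ.+ x r) < g (2 ℕ.^ (2 ℕ.* r ℕ.+ 2) ℕ.* p ℕ.+ y r)
  g-x<g-y p r 1≤r = g-offset-< (2 ℕ.* r ℕ.+ 2) p x-bound y-bound gdiff σ (subst (0ℚ <_) expand Δ>0)
    where
    w = ½^ (2 ℕ.* r)
    X = fromℕ (x r)
    x-bound : x r ℕ.< 2 ℕ.^ (2 ℕ.* r ℕ.+ 2)
    x-bound = subst (x r ℕ.<_) (sym (2^[n+2] (2 ℕ.* r))) (ℕ.m<n⇒m<o*n 2 (ℕ.m<n⇒m<o*n 2 (x<4^ r)))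
    y-bound : y r ℕ.< 2 ℕ.^ (2 ℕ.* r ℕ.+ 2)
    y-bound = subst (y r ℕ.<_) (sym (2^[n+2] (2 ℕ.* r))) (ℕ.m<n⇒m<o*n 2 (ℕ.*-monoʳ-< 2 (x<4^ r)))
    gdiff : g (y r) - g (x r) ≡ + 1 / 9 * (1ℚ - w)
    gdiff = trans (cong (_- g (x r)) (g-2x r))
                  (solve 2 (λ γ w → γ :+ con (+ 1 / 9) :* (con 1ℚ :- w) :- γ := con (+ 1 / 9) :* (con 1ℚ :- w)) refl (g (x r)) w)
    σ : (fromℕ (y r) - X) * ½^ (2 ℕ.* r ℕ.+ 2) ≡ + 1 / 6 * (1ℚ - w)
    σ = begin
      (fromℕ (y r) - X) * ½^ (2 ℕ.* r ℕ.+ 2) ≡⟨ cong₂ (λ u v → (u - X) * v) (fromℕ-2* (x r)) (½^[n+2] (2 ℕ.* r)) ⟩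
      (X + X - X) * (½ * (½ * w))            ≡⟨ solve 2 (λ X w → (X :+ X :- X) :* (con ½ :* (con ½ :* w)) := con ½ :* (con ½ :* (X :* w))) refl X w ⟩
      ½ * (½ * (X * w))                      ≡⟨ cong (λ v → ½ * (½ * v)) (fromℕ-x*½^ r) ⟩
      ½ * (½ * (⅔ * (1ℚ - w)))               ≡⟨ solve 1 (λ w → con ½ :* (con ½ :* (con ⅔ :* (con 1ℚ :- w))) := con (+ 1 / 6) :* (con 1ℚ :- w)) refl w ⟩
      + 1 / 6 * (1ℚ - w)                     ∎
    expand : + 1 / 6 * (1ℚ - w) * (c p + ⅔) ≡ + 1 / 9 * (1ℚ - w) + c p * (+ 1 / 6 * (1ℚ - w))
    expand = solve 2 (λ w κ → con (+ 1 / 6) :* (con 1ℚ :- w) :* (κ :+ con ⅔)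
                            := con (+ 1 / 9) :* (con 1ℚ :- w) :+ κ :* (con (+ 1 / 6) :* (con 1ℚ :- w))) refl w (c p)
    Δ>0 : 0ℚ < + 1 / 6 * (1ℚ - w) * (c p + ⅔)
    Δ>0 = *-pos (*-pos 0<⅙ (½^-<1 (ℕ.≤-trans 1≤r (ℕ.m≤m+n r (r ℕ.+ 0))))) (proj₁ (c-bounds p))

  g-2*4^+y<g-x[1+r] : ∀ p r → 1 ℕ.≤ p → 1 ℕ.≤ r →
    g (2 ℕ.^ (2 ℕ.* r ℕ.+ 2) ℕ.* p ℕ.+ 2 ℕ.^ (2 ℕ.* r ℕ.+ 1) ℕ.+ y r) < g (2 ℕ.^ (2 ℕ.* r ℕ.+ 2) ℕ.* p ℕ.+ x (r ℕ.+ 1))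
  g-2*4^+y<g-x[1+r] p r 1≤p 1≤r =
    subst₂ (λ m n → g m < g n) (sym L≡) (cong (λ k → A ℕ.+ x k) (ℕ.+-comm 1 r))
           (g-offset-< (2 ℕ.* r ℕ.+ 2) p 2Q-bound x-bound gdiff σ (subst (0ℚ <_) expand Δ>0))
    where
    A = 2 ℕ.^ (2 ℕ.* r ℕ.+ 2) ℕ.* p
    P = 2 ℕ.^ (2 ℕ.* r)
    w = ½^ (2 ℕ.* r)
    X = fromℕ (x r)
    E = fromℕ P
    L≡ : A ℕ.+ 2 ℕ.^ (2 ℕ.* r ℕ.+ 1) ℕ.+ y r ≡ A ℕ.+ 2 ℕ.* (P ℕ.+ x r)
    L≡ = trans (ℕ.+-assoc A _ (y r))
               (cong (A ℕ.+_) (trans (cong (ℕ._+ y r) (2^[n+1] (2 ℕ.* r))) (sym (ℕ.*-distribˡ-+ 2 P (x r)))))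
    2Q-bound : 2 ℕ.* (P ℕ.+ x r) ℕ.< 2 ℕ.^ (2 ℕ.* r ℕ.+ 2)
    2Q-bound = subst (2 ℕ.* (P ℕ.+ x r) ℕ.<_) (sym (2^[n+2] (2 ℕ.* r))) (ℕ.*-monoʳ-< 2 (4^+x<2*4^ r))
    x-bound : x (suc r) ℕ.< 2 ℕ.^ (2 ℕ.* r ℕ.+ 2)
    x-bound = subst (x (suc r) ℕ.<_) (trans (cong (2 ℕ.^_) (ℕ.*-suc 2 r)) (sym (2^[n+2] (2 ℕ.* r)))) (x<4^ (suc r))
    gdiff : g (x (suc r)) - g (2 ℕ.* (P ℕ.+ x r)) ≡ 0ℚ
    gdiff = trans (cong₂ _-_ (g-x-suc r) (g-2[4^+x] r)) (ℚ.+-inverseʳ (g (x r) + + 1 / 18 * (+ 4 / 1 - w)))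
    σ : (fromℕ (x (suc r)) - fromℕ (2 ℕ.* (P ℕ.+ x r))) * ½^ (2 ℕ.* r ℕ.+ 2) ≡ - (+ 1 / 6) * (1ℚ - w)
    σ = begin
      (fromℕ (x (suc r)) - fromℕ (2 ℕ.* (P ℕ.+ x r))) * ½^ (2 ℕ.* r ℕ.+ 2)
        ≡⟨ cong₂ (λ u v → (u - v) * ½^ (2 ℕ.* r ℕ.+ 2)) (fromℕ-x-suc r)
                 (trans (fromℕ-2* (P ℕ.+ x r)) (cong₂ _+_ (fromℕ-+ P (x r)) (fromℕ-+ P (x r)))) ⟩
      ((1ℚ + (X + X)) + (1ℚ + (X + X)) - ((E + X) + (E + X))) * ½^ (2 ℕ.* r ℕ.+ 2)
        ≡⟨ cong (λ v → ((1ℚ + (X + X)) + (1ℚ + (X + X)) - ((E + X) + (E + X))) * v) (½^[n+2] (2 ℕ.* r)) ⟩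
      ((1ℚ + (X + X)) + (1ℚ + (X + X)) - ((E + X) + (E + X))) * (½ * (½ * w))
        ≡⟨ solve 3 (λ X E w → ((con 1ℚ :+ (X :+ X)) :+ (con 1ℚ :+ (X :+ X)) :- ((E :+ X) :+ (E :+ X))) :* (con ½ :* (con ½ :* w))
                            := con ½ :* (X :* w) :+ con ½ :* w :- con ½ :* (E :* w)) refl X E w ⟩
      ½ * (X * w) + ½ * w - ½ * (E * w)
        ≡⟨ cong₂ (λ u v → ½ * u + ½ * w - ½ * v) (fromℕ-x*½^ r) (fromℕ-2^*½^ (2 ℕ.* r)) ⟩
      ½ * (⅔ * (1ℚ - w)) + ½ * w - ½ * 1ℚ
        ≡⟨ solve 1 (λ w → con ½ :* (con ⅔ :* (con 1ℚ :- w)) :+ con ½ :* w :- con ½ :* con 1ℚ := con (- (+ 1 / 6)) :* (con 1ℚ :- w)) refl w ⟩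
      - (+ 1 / 6) * (1ℚ - w) ∎
    expand : + 1 / 6 * (1ℚ - w) * - c p ≡ 0ℚ + c p * (- (+ 1 / 6) * (1ℚ - w))
    expand = solve 2 (λ w κ → con (+ 1 / 6) :* (con 1ℚ :- w) :* (:- κ) := con 0ℚ :+ κ :* (con (- (+ 1 / 6)) :* (con 1ℚ :- w))) refl w (c p)
    Δ>0 : 0ℚ < + 1 / 6 * (1ℚ - w) * - c p
    Δ>0 = *-pos (*-pos 0<⅙ (½^-<1 (ℕ.≤-trans 1≤r (ℕ.m≤m+n r (r ℕ.+ 0))))) (c<0 1≤p)

  g-y[r∸1]<g-x : ∀ p r → 1 ℕ.≤ r →
    g (2 ℕ.^ (2 ℕ.* r ℕ.+ 1) ℕ.* p ℕ.+ y (r ℕ.∸ 1)) < g (2 ℕ.^ (2 ℕ.* r ℕ.+ 1) ℕ.* p ℕ.+ x r)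
  g-y[r∸1]<g-x p (suc s) _ = g-offset-< (2 ℕ.* suc s ℕ.+ 1) p y-bound x-bound gdiff σ (subst (0ℚ <_) expand Δ>0)
    where
    w = ½^ (2 ℕ.* s)
    X = fromℕ (x s)
    2^K≡ : 2 ℕ.^ (2 ℕ.* suc s ℕ.+ 1) ≡ 2 ℕ.* 2 ℕ.^ (2 ℕ.* suc s)
    2^K≡ = 2^[n+1] (2 ℕ.* suc s)
    y-bound : y s ℕ.< 2 ℕ.^ (2 ℕ.* suc s ℕ.+ 1)
    y-bound = subst (y s ℕ.<_) (sym (trans 2^K≡ (cong (λ k → 2 ℕ.* 2 ℕ.^ k) (ℕ.*-suc 2 s))))
                    (ℕ.m<n⇒m<o*n 2 (ℕ.m<n⇒m<o*n 2 (ℕ.*-monoʳ-< 2 (x<4^ s))))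
    x-bound : x (suc s) ℕ.< 2 ℕ.^ (2 ℕ.* suc s ℕ.+ 1)
    x-bound = subst (x (suc s) ℕ.<_) (sym 2^K≡) (ℕ.m<n⇒m<o*n 2 (x<4^ (suc s)))
    gdiff : g (x (suc s)) - g (y s) ≡ + 1 / 18 * (+ 2 / 1 + w)
    gdiff = trans (cong₂ _-_ (g-x-suc s) (g-2x s))
                  (solve 2 (λ γ w → γ :+ con (+ 1 / 18) :* (con (+ 4 / 1) :- w) :- (γ :+ con (+ 1 / 9) :* (con 1ℚ :- w))
                                  := con (+ 1 / 18) :* (con (+ 2 / 1) :+ w)) refl (g (x s)) w)
    σ : (fromℕ (x (suc s)) - fromℕ (y s)) * ½^ (2 ℕ.* suc s ℕ.+ 1) ≡ + 1 / 12 * (+ 2 / 1 + w)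
    σ = begin
      (fromℕ (x (suc s)) - fromℕ (y s)) * ½^ (2 ℕ.* suc s ℕ.+ 1)
        ≡⟨ cong₂ (λ u v → (u - v) * ½^ (2 ℕ.* suc s ℕ.+ 1)) (fromℕ-x-suc s) (fromℕ-2* (x s)) ⟩
      ((1ℚ + (X + X)) + (1ℚ + (X + X)) - (X + X)) * ½^ (2 ℕ.* suc s ℕ.+ 1)
        ≡⟨ cong (λ v → ((1ℚ + (X + X)) + (1ℚ + (X + X)) - (X + X)) * v) (trans (½^[n+1] (2 ℕ.* suc s)) (cong (½ *_) (½^-2*suc s))) ⟩
      ((1ℚ + (X + X)) + (1ℚ + (X + X)) - (X + X)) * (½ * (½ * (½ * w)))
        ≡⟨ solve 2 (λ X w → ((con 1ℚ :+ (X :+ X)) :+ (con 1ℚ :+ (X :+ X)) :- (X :+ X)) :* (con ½ :* (con ½ :* (con ½ :* w)))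
                          := con ½ :* (con ½ :* w) :+ con ½ :* (con ½ :* (X :* w))) refl X w ⟩
      ½ * (½ * w) + ½ * (½ * (X * w))  ≡⟨ cong (λ v → ½ * (½ * w) + ½ * (½ * v)) (fromℕ-x*½^ s) ⟩
      ½ * (½ * w) + ½ * (½ * (⅔ * (1ℚ - w)))
        ≡⟨ solve 1 (λ w → con ½ :* (con ½ :* w) :+ con ½ :* (con ½ :* (con ⅔ :* (con 1ℚ :- w))) := con (+ 1 / 12) :* (con (+ 2 / 1) :+ w)) refl w ⟩
      + 1 / 12 * (+ 2 / 1 + w) ∎
    expand : + 1 / 12 * (+ 2 / 1 + w) * (c p + ⅔) ≡ + 1 / 18 * (+ 2 / 1 + w) + c p * (+ 1 / 12 * (+ 2 / 1 + w))
    expand = solve 2 (λ w κ → con (+ 1 / 12) :* (con (+ 2 / 1) :+ w) :* (κ :+ con ⅔)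
                            := con (+ 1 / 18) :* (con (+ 2 / 1) :+ w) :+ κ :* (con (+ 1 / 12) :* (con (+ 2 / 1) :+ w))) refl w (c p)
    Δ>0 : 0ℚ < + 1 / 12 * (+ 2 / 1 + w) * (c p + ⅔)
    Δ>0 = *-pos (*-pos (ℚ.positive⁻¹ (+ 1 / 12)) (ℚ.+-mono-< (ℚ.positive⁻¹ (+ 2 / 1)) (½^-pos (2 ℕ.* s)))) (proj₁ (c-bounds p))

  g-4^+x<g-y : ∀ p r → 1 ℕ.≤ p →
    g (2 ℕ.^ (2 ℕ.* r ℕ.+ 1) ℕ.* p ℕ.+ 2 ℕ.^ (2 ℕ.* r) ℕ.+ x r) < g (2 ℕ.^ (2 ℕ.* r ℕ.+ 1) ℕ.* p ℕ.+ y r)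
  g-4^+x<g-y p r 1≤p =
    subst (λ m → g m < g (A ℕ.+ y r)) (sym (ℕ.+-assoc A P (x r)))
          (g-offset-< (2 ℕ.* r ℕ.+ 1) p Q-bound y-bound gdiff σ (subst (0ℚ <_) expand Δ>0))
    where
    A = 2 ℕ.^ (2 ℕ.* r ℕ.+ 1) ℕ.* p
    P = 2 ℕ.^ (2 ℕ.* r)
    w = ½^ (2 ℕ.* r)
    X = fromℕ (x r)
    E = fromℕ P
    Q-bound : P ℕ.+ x r ℕ.< 2 ℕ.^ (2 ℕ.* r ℕ.+ 1)
    Q-bound = subst (P ℕ.+ x r ℕ.<_) (sym (2^[n+1] (2 ℕ.* r))) (4^+x<2*4^ r)
    y-bound : y r ℕ.< 2 ℕ.^ (2 ℕ.* r ℕ.+ 1)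
    y-bound = subst (y r ℕ.<_) (sym (2^[n+1] (2 ℕ.* r))) (ℕ.*-monoʳ-< 2 (x<4^ r))
    gdiff : g (y r) - g (P ℕ.+ x r) ≡ 0ℚ
    gdiff = trans (cong₂ _-_ (g-2x r) (g-4^+x r)) (ℚ.+-inverseʳ (g (x r) + + 1 / 9 * (1ℚ - w)))
    σ : (fromℕ (y r) - fromℕ (P ℕ.+ x r)) * ½^ (2 ℕ.* r ℕ.+ 1) ≡ - (+ 1 / 6) * (1ℚ + + 2 / 1 * w)
    σ = begin
      (fromℕ (y r) - fromℕ (P ℕ.+ x r)) * ½^ (2 ℕ.* r ℕ.+ 1)
        ≡⟨ cong₂ (λ u v → (u - v) * ½^ (2 ℕ.* r ℕ.+ 1)) (fromℕ-2* (x r)) (fromℕ-+ P (x r)) ⟩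
      (X + X - (E + X)) * ½^ (2 ℕ.* r ℕ.+ 1)  ≡⟨ cong (λ v → (X + X - (E + X)) * v) (½^[n+1] (2 ℕ.* r)) ⟩
      (X + X - (E + X)) * (½ * w)
        ≡⟨ solve 3 (λ X E w → (X :+ X :- (E :+ X)) :* (con ½ :* w) := con ½ :* (X :* w) :- con ½ :* (E :* w)) refl X E w ⟩
      ½ * (X * w) - ½ * (E * w)               ≡⟨ cong₂ (λ u v → ½ * u - ½ * v) (fromℕ-x*½^ r) (fromℕ-2^*½^ (2 ℕ.* r)) ⟩
      ½ * (⅔ * (1ℚ - w)) - ½ * 1ℚ
        ≡⟨ solve 1 (λ w → con ½ :* (con ⅔ :* (con 1ℚ :- w)) :- con ½ :* con 1ℚ := con (- (+ 1 / 6)) :* (con 1ℚ :+ con (+ 2 / 1) :* w)) refl w ⟩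
      - (+ 1 / 6) * (1ℚ + + 2 / 1 * w) ∎
    expand : + 1 / 6 * (1ℚ + + 2 / 1 * w) * - c p ≡ 0ℚ + c p * (- (+ 1 / 6) * (1ℚ + + 2 / 1 * w))
    expand = solve 2 (λ w κ → con (+ 1 / 6) :* (con 1ℚ :+ con (+ 2 / 1) :* w) :* (:- κ)
                            := con 0ℚ :+ κ :* (con (- (+ 1 / 6)) :* (con 1ℚ :+ con (+ 2 / 1) :* w))) refl w (c p)
    Δ>0 : 0ℚ < + 1 / 6 * (1ℚ + + 2 / 1 * w) * - c p
    Δ>0 = *-pos (*-pos 0<⅙ (ℚ.+-mono-< (ℚ.positive⁻¹ 1ℚ) (*-pos (ℚ.positive⁻¹ (+ 2 / 1)) (½^-pos (2 ℕ.* r))))) (c<0 1≤p)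

open import Defs
open import Data.Nat using (ℕ; suc; _+_; _*_; _^_; _∸_)
open import Data.Rational using (_<_)
open import Data.Product using (_×_; _,_)
open Properties using (g-x<g-y; g-2*4^+y<g-x[1+r]; g-y[r∸1]<g-x; g-4^+x<g-y)

corollary6 : (p r : ℕ) → 1 Data.Nat.≤ p → 1 Data.Nat.≤ r →
    (g (2 ^ (2 * r + 2) * p + x r) < g (2 ^ (2 * r + 2) * p + y r))
    × (g (2 ^ (2 * r + 2) * p + 2 ^ (2 * r + 1) + y r) < g (2 ^ (2 * r + 2) * p + x (r + 1)))
    × (g (2 ^ (2 * r + 1) * p + y (r ∸ 1)) < g (2 ^ (2 * r + 1) * p + x r))
    × (g (2 ^ (2 * r + 1) * p + 2 ^ (2 * r) + x r) < g (2 ^ (2 * r + 1) * p + y r))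
corollary6 p r 1≤p 1≤r =
  g-x<g-y p r 1≤r , g-2*4^+y<g-x[1+r] p r 1≤p 1≤r , g-y[r∸1]<g-x p r 1≤r , g-4^+x<g-y p r 1≤p
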